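{- Let $\mathcal M$ be a sweep oriented matroid on $\binom{[n]}{2}$ with little oriented matroid $\mathcal L(\mathcal M)$. Then there is a weak map from the first Dilworth truncation $D(\underline{\mathcal L(\mathcal M)})$ to $\underline{\mathcal M}$; that is, $\mathrm{rk}_{\underline{\mathcal M}}(G)\le \mathrm{rk}_{D(\underline{\mathcal L(\mathcal M)})}(G)$ for every $G\subseteq\binom{[n]}{2}$.
   Context: For an oriented matroid $\mathcal N$ on $E$ (given by covectors), $\underline{\mathcal N}$ is its underlying matroid; the rank $\mathrm{rk}_{\mathcal N}(S)$ of $S\subseteq E$ is the rank (length of maximal chains of covectors, order $0\prec\pm$) of the restriction $\{X|_S\}$. For a matroid $\underline{\mathcal N}$ on $E$, the first Dilworth truncation $D(\underline{\mathcal N})$ is the matroid on the set $\binom{E}{2}$ of pairs of elements of $E$ with rank function $\mathrm{rk}(\emptyset)=0$ and, for nonempty $F$, $\mathrm{rk}(F)=\min\sum_{k=1}^{l}\big(\mathrm{rk}_{\underline{\mathcal N}}(\bigcup\{\{i,j\}:(i,j)\in F_k\})-1\big)$, the minimum over all unordered partitions $\{F_1,\dots,F_l\}$ of $F$ into nonempty parts. $\binom{[n]}{2}$ is the set of pairs $(i,j)$, $i<j$; for an ordered partition $I$ of $[n]$ with block-index map $p_I$, $X^I_{(i,j)}=+,-,0$ according as $p_I(i)<,>,=p_I(j)$; a sweep oriented matroid is an oriented matroid on $\binom{[n]}{2}$ all of whose covectors are of the form $X^I$. For a covector $X=X^{I_X}$ with $l_X$ blocks, $p_X=p_{I_X}$,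 and $1\le k\le2l_X+1$, $X^k$ on $[n]\cup\binom{[n]}{2}$ has $X^k_{(i,j)}=X_{(i,j)}$ and $X^k_i=-$ if $p_X(i)\le\lfloor\frac{k-1}{2}\rfloor$, $+$ if $p_X(i)>\lfloor\frac k2\rfloor$, $0$ if $k$ even and $p_X(i)=\frac k2$. The little oriented matroid $\mathcal L(\mathcal M)$ is the restriction to $[n]$ of the oriented matroid $\{X^k: X\in\mathcal M,1\le k\le 2l_X+1\}$. -}

module Defs where

open import Data.Nat using (ℕ; zero; suc; _≤_; _<_; _≤?_; _<?_; ⌊_/2⌋; _∸_)
open import Data.Fin using (Fin; toℕ; inject₁) renaming (zero to fzero; suc to fsuc)
import Data.Fin as F
open import Data.Integer as ℤ using (ℤ; +_; _-_)
open import Data.Bool using (Bool; true)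
open import Data.Product using (Σ; ∃; ∃-syntax; _×_; _,_; proj₁; proj₂)
open import Data.Sum using (_⊎_)
open import Relation.Nullary using (¬_; yes; no)
open import Relation.Binary.PropositionalEquality using (_≡_; _≢_)

data Sign : Set where
  ⊕ ⊖ 𝟘 : Sign

opp : Sign → Sign
opp ⊕ = ⊖
opp ⊖ = ⊕
opp 𝟘 = 𝟘

data _≼_ : Sign → Sign → Set where
  ≼-refl : ∀ {s} → s ≼ s
  𝟘≼ : ∀ {s} → 𝟘 ≼ s

_∘ₛ_ : ∀ {E : Set} → (E → Sign) → (E → Sign) → (E → Sign)
(X ∘ₛ Y) e with X e
... | 𝟘 = Y e
... | s = s

Sep : ∀ {E : Set} → (E → Sign) → (E → Sign) → E → Set
Sep X Y e = (X e ≡ opp (Y e)) × (X e ≢ 𝟘)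

record OrientedMatroid (E : Set) : Set₁ where
  field
    Cov      : (E → Sign) → Set
    cov-ext  : ∀ {X Y} → Cov X → (∀ e → X e ≡ Y e) → Cov Y
    cov-zero : Cov (λ _ → 𝟘)
    cov-neg  : ∀ {X} → Cov X → Cov (λ e → opp (X e))
    cov-comp : ∀ {X Y} → Cov X → Cov Y → Cov (X ∘ₛ Y)
    cov-elim : ∀ {X Y} → Cov X → Cov Y → ∀ e → Sep X Y e →
               ∃[ Z ] (Cov Z × (Z e ≡ 𝟘) ×
                       (∀ f → ¬ Sep X Y f → Z f ≡ (X ∘ₛ Y) f))
open OrientedMatroid public

-- Rank of the restriction of a covector set C to S ⊆ E:
-- length of the longest (= any maximal) chain of restricted covectors
-- with respect to the componentwise order 0 ≺ ±.

Step : ∀ {E : Set} → (E → Set) → (E → Sign) → (E → Sign) → Set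
Step S X Y = (∀ e → S e → X e ≼ Y e) × (∃[ e ] (S e × (X e ≢ Y e)))

Chain : ∀ {E : Set} → ((E → Sign) → Set) → (E → Set) → ℕ → Set
Chain {E} C S r =
  Σ (Fin (suc r) → (E → Sign)) λ ch →
    (∀ i → C (ch i)) × (∀ (i : Fin r) → Step S (ch (inject₁ i)) (ch (fsuc i)))

IsRank : ∀ {E : Set} → ((E → Sign) → Set) → (E → Set) → ℕ → Set
IsRank C S r = Chain C S r × (∀ m → Chain C S m → m ≤ r)

Pair : ℕ → Set
Pair n = Σ (Fin n) λ i → Σ (Fin n) λ j → i F.< j

fstP : ∀ {n} → Pair n → Fin n
fstP (i , _ , _) = i

sndP : ∀ {n} → Pair n → Fin n
sndP (_ , j , _) = j

-- Ordered partitions of [n] into l nonempty blocks, given by the block map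
-- p : Fin n → Fin l (block index p(i)+1 ∈ {1..l}), surjective.

Surj : ∀ {n l} → (Fin n → Fin l) → Set
Surj {n} {l} p = ∀ (b : Fin l) → ∃[ i ] (p i ≡ b)

sweepSign : ∀ {n l} → (Fin n → Fin l) → Pair n → Sign
sweepSign p (i , j , _) with toℕ (p i) <? toℕ (p j) | toℕ (p j) <? toℕ (p i)
... | yes _ | _     = ⊕
... | no _  | yes _ = ⊖
... | no _  | no _  = 𝟘

IsSweepCovector : ∀ {n} → (Pair n → Sign) → Set
IsSweepCovector {n} X =
  ∃[ l ] Σ (Fin n → Fin l) λ p → Surj p × (∀ e → X e ≡ sweepSign p e)

IsSweep : ∀ {n} → OrientedMatroid (Pair n) → Set
IsSweep {n} M = ∀ X → Cov M X → IsSweepCovector X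

littleSign : ℕ → ℕ → Sign
littleSign q k with q ≤? ⌊ k ∸ 1 /2⌋
... | yes _ = ⊖
... | no _ with ⌊ k /2⌋ <? q
...   | yes _ = ⊕
...   | no _  = 𝟘

LittleCov : ∀ {n} → OrientedMatroid (Pair n) → (Fin n → Sign) → Set
LittleCov {n} M Y =
  ∃[ X ] (Cov M X × ∃[ l ] Σ (Fin n → Fin l) λ p →
     Surj p × (∀ e → X e ≡ sweepSign p e) ×
     ∃[ k ] ((1 ≤ k) × (k ≤ suc (l Data.Nat.+ l)) ×
             (∀ i → Y i ≡ littleSign (suc (toℕ (p i))) k)))

-- First Dilworth truncation, rank relation.
-- Subsets of Pair n are Bool-valued; a partition of G into l nonempty parts
-- is a map c : Pair n → Fin l (relevant on G only), each part nonempty.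

sumFin : ∀ {l} → (Fin l → ℤ) → ℤ
sumFin {zero} f = + 0
sumFin {suc l} f = f fzero ℤ.+ sumFin (λ k → f (fsuc k))

In : ∀ {n} → (Pair n → Bool) → Pair n → Set
In G e = G e ≡ true

IsPartition : ∀ {n l} → (Pair n → Bool) → (Pair n → Fin l) → Set
IsPartition {n} {l} G c = ∀ (k : Fin l) → ∃[ e ] (In G e × (c e ≡ k))

UnionPart : ∀ {n l} → (Pair n → Bool) → (Pair n → Fin l) → Fin l → Fin n → Set
UnionPart G c k i = ∃[ e ] (In G e × (c e ≡ k) × ((i ≡ fstP e) ⊎ (i ≡ sndP e)))

PartitionValue : ∀ {n} → ((Fin n → Sign) → Set) → (Pair n → Bool) → ℤ → Set
PartitionValue {n} C G v =
  ∃[ l ] Σ (Pair n → Fin l) λ c → IsPartition G c ×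
    Σ (Fin l → ℕ) λ rs → (∀ k → IsRank C (UnionPart G c k) (rs k)) ×
      (v ≡ sumFin (λ k → + rs k - + 1))

Empty : ∀ {n} → (Pair n → Bool) → Set
Empty G = ∀ e → ¬ In G e

IsDRank : ∀ {n} → ((Fin n → Sign) → Set) → (Pair n → Bool) → ℤ → Set
IsDRank C G s =
  (Empty G × (s ≡ + 0)) ⊎
  ((¬ Empty G) × PartitionValue C G s × (∀ v → PartitionValue C G v → s ℤ.≤ v))

-- A chain of covectors of M restricted to G splits, along any partition {F_k} of G, into chains
-- restricted to the parts whose lengths add up to at least its own.  So it suffices that a chain
-- of length d of M restricted to pairs inside a set U ⊆ [n] yields a chain of length d + 1 of
-- L(M) restricted to U.  Fix i₀ ∈ U.  A sweep covector vanishing on the star {i₀u : u ∈ U} puts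
-- all of U into one block, hence vanishes on every pair inside U: these pairs lie in the closure
-- of the star, and by covector elimination the chain can be traded for one of the same length on
-- the star.  There a covector X is recorded faithfully by X^{2q}|U, q the block of i₀, which is 0
-- at i₀; appending X^{2q+1}|U, which is − at i₀, gives the extra step.

module Submission where

open import Defs
open import Data.Nat using (ℕ)
open import Data.Integer using (ℤ; +_; _≤_)
open import Data.Bool using (Bool)

open import Data.Nat as ℕ using (zero; suc; _+_; _∸_; z≤n; s≤s; ⌊_/2⌋; _<?_; _≤?_)
import Data.Nat.Properties as ℕP
open import Data.Integer using (_-_; +≤+)
import Data.Integer.Properties as ℤP
open import Data.Fin as F using (Fin; toℕ; inject₁) renaming (zero to fzero; suc to fsuc)
import Data.Fin.Properties as FP
open import Data.Vec.Functional using (foldr; updateAt)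
open import Data.Vec.Functional.Properties using (updateAt-updates; updateAt-minimal)
open import Data.List using (List; []; _∷_; concatMap; allFin)
open import Data.List.Membership.Propositional using (_∈_; lose)
open import Data.List.Membership.Propositional.Properties using (∈-concatMap⁺; ∈-allFin)
open import Data.List.Relation.Unary.Any using (here; there)
open import Data.Product using (∃; ∃-syntax; _×_; _,_; proj₁; proj₂)
open import Data.Sum using (_⊎_; inj₁; inj₂)
open import Effect.Monad using (RawMonad)
open import Relation.Nullary using (¬_; Dec; yes; no; ¬?; _×-dec_)
open import Relation.Nullary.Negation using (¬¬-Monad; ¬¬-map; contradiction)
open import Relation.Nullary.Decidable using (¬¬-excluded-middle; decidable-stable)
open import Relation.Unary using (Decidable)
open import Relation.Binary.Definitions using (DecidableEquality; tri<; tri≈; tri>)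
open import Relation.Binary.PropositionalEquality
open import Function using (_∘′_)
open import Level using (0ℓ)

open RawMonad (¬¬-Monad {0ℓ}) using (pure; _>>=_)

SignVector : Set → Set
SignVector E = E → Sign

_≟ₛ_ : DecidableEquality Sign
⊕ ≟ₛ ⊕ = yes refl
⊖ ≟ₛ ⊖ = yes refl
𝟘 ≟ₛ 𝟘 = yes refl
⊕ ≟ₛ ⊖ = no λ ()
⊕ ≟ₛ 𝟘 = no λ ()
⊖ ≟ₛ ⊕ = no λ ()
⊖ ≟ₛ 𝟘 = no λ ()
𝟘 ≟ₛ ⊕ = no λ ()
𝟘 ≟ₛ ⊖ = no λ ()

opp-involutive : ∀ a → opp (opp a) ≡ a
opp-involutive ⊕ = refl
opp-involutive ⊖ = refl
opp-involutive 𝟘 = refl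

opp-injective : ∀ {a b} → opp a ≡ opp b → a ≡ b
opp-injective {a} {b} eq = trans (sym (opp-involutive a)) (trans (cong opp eq) (opp-involutive b))

≢𝟘⇒≢opp : ∀ {a} → a ≢ 𝟘 → a ≢ opp a
≢𝟘⇒≢opp {⊕} _ ()
≢𝟘⇒≢opp {⊖} _ ()
≢𝟘⇒≢opp {𝟘} a≢𝟘 _ = a≢𝟘 refl

≼-reflexive : ∀ {a b} → a ≡ b → a ≼ b
≼-reflexive refl = ≼-refl

≼-trans : ∀ {a b c} → a ≼ b → b ≼ c → a ≼ c
≼-trans ≼-refl b≼c = b≼c
≼-trans 𝟘≼ _ = 𝟘≼

≼-antisym : ∀ {a b} → a ≼ b → b ≼ a → a ≡ b
≼-antisym ≼-refl _ = refl
≼-antisym 𝟘≼ ≼-refl = refl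
≼-antisym 𝟘≼ 𝟘≼ = refl

≼𝟘⇒≡𝟘 : ∀ {a} → a ≼ 𝟘 → a ≡ 𝟘
≼𝟘⇒≡𝟘 ≼-refl = refl
≼𝟘⇒≡𝟘 𝟘≼ = refl

≼∧≢𝟘⇒≡ : ∀ {a b} → a ≼ b → a ≢ 𝟘 → a ≡ b
≼∧≢𝟘⇒≡ ≼-refl _ = refl
≼∧≢𝟘⇒≡ 𝟘≼ a≢𝟘 = contradiction refl a≢𝟘

≼∧≢⇒≡𝟘 : ∀ {a b} → a ≼ b → a ≢ b → a ≡ 𝟘
≼∧≢⇒≡𝟘 ≼-refl a≢b = contradiction refl a≢b
≼∧≢⇒≡𝟘 𝟘≼ _ = refl

≢opp⇒≡ : ∀ {a b} → a ≢ 𝟘 → b ≢ 𝟘 → a ≢ opp b → a ≡ b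
≢opp⇒≡ {⊕} {⊕} _ _ _ = refl
≢opp⇒≡ {⊖} {⊖} _ _ _ = refl
≢opp⇒≡ {⊕} {⊖} _ _ a≢-b = contradiction refl a≢-b
≢opp⇒≡ {⊖} {⊕} _ _ a≢-b = contradiction refl a≢-b
≢opp⇒≡ {𝟘} a≢𝟘 _ _ = contradiction refl a≢𝟘
≢opp⇒≡ {b = 𝟘} _ b≢𝟘 _ = contradiction refl b≢𝟘

¬Sep-≡ : ∀ {a b} → a ≡ b → ¬ (a ≡ opp b × a ≢ 𝟘)
¬Sep-≡ refl (a≡-a , a≢𝟘) = ≢𝟘⇒≢opp a≢𝟘 a≡-a

¬Sep-𝟘ʳ : ∀ {a b} → b ≡ 𝟘 → ¬ (a ≡ opp b × a ≢ 𝟘)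
¬Sep-𝟘ʳ refl (a≡𝟘 , a≢𝟘) = a≢𝟘 a≡𝟘

opp-mono-≼ : ∀ {a b} → a ≼ b → opp a ≼ opp b
opp-mono-≼ ≼-refl = ≼-refl
opp-mono-≼ 𝟘≼ = 𝟘≼

module _ {E : Set} (X Y : SignVector E) (e : E) where

  ∘ₛ-≢𝟘 : X e ≢ 𝟘 → (X ∘ₛ Y) e ≡ X e
  ∘ₛ-≢𝟘 X≢𝟘 with X e
  ... | ⊕ = refl
  ... | ⊖ = refl
  ... | 𝟘 = contradiction refl X≢𝟘

  ∘ₛ-𝟘 : X e ≡ 𝟘 → (X ∘ₛ Y) e ≡ Y e
  ∘ₛ-𝟘 X≡𝟘 with X e
  ... | 𝟘 = refl

  ≼-∘ₛ : X e ≼ (X ∘ₛ Y) e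
  ≼-∘ₛ with X e ≟ₛ 𝟘
  ... | yes X≡𝟘 rewrite X≡𝟘 = 𝟘≼
  ... | no X≢𝟘 = ≼-reflexive (sym (∘ₛ-≢𝟘 X≢𝟘))

  sep? : Dec (Sep X Y e)
  sep? = (X e ≟ₛ opp (Y e)) ×-dec ¬? (X e ≟ₛ 𝟘)

count : ∀ {E : Set} {P : E → Set} → Decidable P → List E → ℕ
count P? [] = 0
count P? (x ∷ xs) with P? x
... | yes _ = suc (count P? xs)
... | no _ = count P? xs

module _ {E : Set} {P Q : E → Set} (P? : Decidable P) (Q? : Decidable Q)
         (Q⊆P : ∀ x → Q x → P x) where

  count-mono : ∀ xs → count Q? xs ℕ.≤ count P? xs
  count-mono [] = z≤n
  count-mono (x ∷ xs) with Q? x | P? x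
  ... | yes _ | yes _ = s≤s (count-mono xs)
  ... | yes q | no ¬p = contradiction (Q⊆P x q) ¬p
  ... | no _ | yes _ = ℕP.m≤n⇒m≤1+n (count-mono xs)
  ... | no _ | no _ = count-mono xs

  count-strict : ∀ {g} xs → g ∈ xs → P g → ¬ Q g → count Q? xs ℕ.< count P? xs
  count-strict {g} (x ∷ xs) (here refl) p ¬q with Q? g | P? g
  ... | yes q | _ = contradiction q ¬q
  ... | no _ | yes _ = s≤s (count-mono xs)
  ... | no _ | no ¬p = contradiction p ¬p
  count-strict (x ∷ xs) (there g∈xs) p ¬q with Q? x | P? x
  ... | yes _ | yes _ = s≤s (count-strict xs g∈xs p ¬q)
  ... | yes q | no ¬p = contradiction (Q⊆P x q) ¬p
  ... | no _ | yes _ = ℕP.m≤n⇒m≤1+n (count-strict xs g∈xs p ¬q)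
  ... | no _ | no _ = count-strict xs g∈xs p ¬q

-- Chains as paths

data Path {E : Set} (C : SignVector E → Set) (T : E → Set) :
          SignVector E → SignVector E → ℕ → Set where
  nil  : ∀ {X} → C X → Path C T X X 0
  cons : ∀ {X Y Z d} → C X → Step T X Y → Path C T Y Z d → Path C T X Z (suc d)

SomePath : ∀ {E : Set} → (SignVector E → Set) → (E → Set) → ℕ → Set
SomePath C T d = ∃[ X ] ∃[ Z ] Path C T X Z d

module _ {E : Set} {C : SignVector E → Set} where

  private
    variable
      S T : E → Set
      X Y Z : SignVector E
      d m : ℕ

  bottom : Path C T X Z d → C X
  bottom (nil cX) = cX
  bottom (cons cX _ _) = cX

  top : Path C T X Z d → C Z
  top (nil cZ) = cZ
  top (cons _ _ p) = top p

  _++ₚ_ : Path C T X Y m → Path C T Y Z d → Path C T X Z (m + d)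
  nil _ ++ₚ q = q
  cons cX st p ++ₚ q = cons cX st (p ++ₚ q)

  snoc : Path C T X Y m → Step T Y Z → C Z → Path C T X Z (suc m)
  snoc (nil cY) st cZ = cons cY st (nil cZ)
  snoc (cons cX st p) st′ cZ = cons cX st (snoc p st′ cZ)

  unsnoc : Path C T X Z (suc m) → ∃[ Y ] (Path C T X Y m × Step T Y Z × C Y)
  unsnoc (cons cX st (nil _)) = _ , nil cX , st , cX
  unsnoc (cons cX st p@(cons _ _ _)) with unsnoc p
  ... | Y , p′ , st′ , cY = Y , cons cX st p′ , st′ , cY

  mapStep : (∀ {X Y} → Step S X Y → Step T X Y) → Path C S X Z d → Path C T X Z d
  mapStep f (nil cX) = nil cX
  mapStep f (cons cX st p) = cons cX (f st) (mapStep f p)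

  private
    element : Path C T X Z d → Fin (suc d) → SignVector E
    element {X = X} (nil _) _ = X
    element {X = X} (cons _ _ _) fzero = X
    element (cons _ _ p) (fsuc i) = element p i

    element-covector : (p : Path C T X Z d) → ∀ i → C (element p i)
    element-covector (nil cX) _ = cX
    element-covector (cons cX _ _) fzero = cX
    element-covector (cons _ _ p) (fsuc i) = element-covector p i

    element-bottom : (p : Path C T X Z d) → element p fzero ≡ X
    element-bottom (nil _) = refl
    element-bottom (cons _ _ _) = refl

    element-step : (p : Path C T X Z d) →
                   ∀ (i : Fin d) → Step T (element p (inject₁ i)) (element p (fsuc i))
    element-step (cons _ st p) fzero = subst (Step _ _) (sym (element-bottom p)) st
    element-step (cons _ _ p) (fsuc i) = element-step p i

  toChain : Path C T X Z d → Chain C T d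
  toChain p = element p , element-covector p , element-step p

  path-≼ : Path C T X Z d → ∀ {e} → T e → X e ≼ Z e
  path-≼ (nil _) _ = ≼-refl
  path-≼ (cons _ (X≼Y , _) p) Te = ≼-trans (X≼Y _ Te) (path-≼ p Te)

  rebase : C X → (∀ y → T y → X y ≡ Y y) → Path C T Y Z d → ∃[ Z′ ] Path C T X Z′ d
  rebase cX _ (nil _) = _ , nil cX
  rebase cX X≐Y (cons _ (Y≼Y′ , w , Tw , Yw≢Y′w) p) =
    _ , cons cX ((λ y Ty → subst (_≼ _) (sym (X≐Y y Ty)) (Y≼Y′ y Ty)) , w , Tw ,
                 λ eq → Yw≢Y′w (trans (sym (X≐Y w Tw)) eq)) p

  fromChain : (ch : Chain C T d) → ∃[ Z ] Path C T (proj₁ ch fzero) Z d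
  fromChain {d = zero} (ch , cov , _) = ch fzero , nil (cov fzero)
  fromChain {d = suc d} (ch , cov , st) =
    let Z , p = fromChain (ch ∘′ fsuc , (λ i → cov (fsuc i)) , (λ i → st (fsuc i)))
    in Z , cons (cov fzero) (st fzero) p

module _ {E : Set} where

  private
    variable
      A B : E → Set
      X Y : SignVector E

  Step-cong : (∀ y → B y → A y) → (∀ y → A y → B y) → Step A X Y → Step B X Y
  Step-cong B⊆A A⊆B (X≼Y , w , Aw , Xw≢Yw) = (λ y By → X≼Y y (B⊆A y By)) , w , A⊆B w Aw , Xw≢Yw

  ∘ₛ-absorbs : ∀ {Z} → (∀ y → A y → Z y ≡ X y) → (∀ y → A y → X y ≼ Y y) →
               ∀ y → A y → (Z ∘ₛ Y) y ≡ Y y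
  ∘ₛ-absorbs {Y = Y} {Z = Z} Z≐X X≼Y y Ay with Z y ≟ₛ 𝟘
  ... | yes Zy≡𝟘 = ∘ₛ-𝟘 Z Y y Zy≡𝟘
  ... | no Zy≢𝟘 = trans (∘ₛ-≢𝟘 Z Y y Zy≢𝟘)
                        (≼∧≢𝟘⇒≡ (subst (_≼ Y y) (sym (Z≐X y Ay)) (X≼Y y Ay)) Zy≢𝟘)

-- Refining chains and dropping closure points

module _ {E : Set} (M : OrientedMatroid E) where

  private
    variable
      F T : E → Set
      A P Q X Y Z : SignVector E
      d : ℕ

  Between : (E → Set) → SignVector E → SignVector E → Set
  Between T P Q = ∃[ D ] (Cov M D × Step T P D × Step T D Q)

  InClosure : (E → Set) → E → Set
  InClosure S e = ∀ W → Cov M W → (∀ s → S s → W s ≡ 𝟘) → W e ≡ 𝟘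

  Eliminant : SignVector E → SignVector E → E → Set
  Eliminant X Y e = ∃[ Z ] (Cov M Z × Z e ≡ 𝟘 × (∀ f → ¬ Sep X Y f → Z f ≡ (X ∘ₛ Y) f))

  module _ {X Y Z : SignVector E} (Z-agrees : ∀ f → ¬ Sep X Y f → Z f ≡ (X ∘ₛ Y) f) where

    eliminant-≢𝟘 : ∀ f → ¬ Sep X Y f → X f ≢ 𝟘 → Z f ≡ X f
    eliminant-≢𝟘 f ¬sep Xf≢𝟘 = trans (Z-agrees f ¬sep) (∘ₛ-≢𝟘 X Y f Xf≢𝟘)

    eliminant-𝟘 : ∀ f → X f ≡ 𝟘 → Z f ≡ Y f
    eliminant-𝟘 f Xf≡𝟘 = trans (Z-agrees f (λ sep → proj₂ sep Xf≡𝟘)) (∘ₛ-𝟘 X Y f Xf≡𝟘)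

  widen : (∀ y → F y → T y) → Cov M A → (∀ y → F y → A y ≡ X y) →
          Path (Cov M) F X Z d → ∃[ Z′ ] Path (Cov M) T A Z′ d
  widen F⊆T cA A≐X (nil _) = _ , nil cA
  widen {A = A} F⊆T cA A≐X (cons {Y = Y} _ (X≼Y , w , Fw , Xw≢Yw) p) =
    let A∘Y≐Y = ∘ₛ-absorbs A≐X X≼Y
        (Z′ , p′) = widen F⊆T (cov-comp M cA (bottom p)) A∘Y≐Y p
        Aw≢A∘Yw = λ eq → Xw≢Yw (trans (sym (A≐X w Fw)) (trans eq (A∘Y≐Y w Fw)))
    in Z′ , cons cA ((λ y _ → ≼-∘ₛ A Y y) , w , F⊆T w Fw , Aw≢A∘Yw) p′

  module Refinement (enum : List E) (enum-complete : ∀ x → x ∈ enum) (T : E → Set) where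

    record Squeezed (P Q Z : SignVector E) : Set where
      field
        agrees   : ∀ y → T y → P y ≢ 𝟘 → Z y ≡ P y
        vanishes : ∀ y → T y → Q y ≡ 𝟘 → Z y ≡ 𝟘
        gap      : ∃[ f ] (T f × Q f ≢ 𝟘 × Z f ≡ 𝟘)

    Exceeds : SignVector E → SignVector E → Set
    Exceeds P Z = ∃[ h ] (T h × P h ≡ 𝟘 × Z h ≢ 𝟘)

    between-if-unseparated : (∀ y → T y → P y ≼ Q y) → Cov M Z → Squeezed P Q Z → Exceeds P Z →
                             (∀ y → T y → ¬ Sep Q Z y) → Between T P Q
    between-if-unseparated {P} {Q} {Z} P≼Q cZ sq@record { gap = f , Tf , Qf≢𝟘 , Zf≡𝟘 }
                           (h , Th , Ph≡𝟘 , Zh≢𝟘) unsep =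
      Z , cZ , (P≼Z , h , Th , λ eq → Zh≢𝟘 (trans (sym eq) Ph≡𝟘)) ,
               (Z≼Q , f , Tf , λ eq → Qf≢𝟘 (trans (sym eq) Zf≡𝟘))
      where
      open Squeezed sq
      P≼Z : ∀ y → T y → P y ≼ Z y
      P≼Z y Ty with P y ≟ₛ 𝟘
      ... | yes Py≡𝟘 rewrite Py≡𝟘 = 𝟘≼
      ... | no Py≢𝟘 = ≼-reflexive (sym (agrees y Ty Py≢𝟘))
      Z≼Q : ∀ y → T y → Z y ≼ Q y
      Z≼Q y Ty with Z y ≟ₛ 𝟘 | Q y ≟ₛ 𝟘
      ... | yes Zy≡𝟘 | _ rewrite Zy≡𝟘 = 𝟘≼
      ... | no Zy≢𝟘 | yes Qy≡𝟘 = contradiction (vanishes y Ty Qy≡𝟘) Zy≢𝟘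
      ... | no Zy≢𝟘 | no Qy≢𝟘 =
        ≼-reflexive (sym (≢opp⇒≡ Qy≢𝟘 Zy≢𝟘 (λ eq → unsep y Ty (eq , Qy≢𝟘))))

    -- Eliminating Q against Z where they separate on T keeps the squeeze and strictly lowers
    -- the number of separations; when none is left on T, Z itself lies strictly between P and Q.
    private
      refine-within : ∀ fuel → Cov M Q → (∀ y → T y → P y ≼ Q y) → Cov M Z → Squeezed P Q Z →
                      Exceeds P Z → count (sep? Q Z) enum ℕ.< fuel → ¬ ¬ Between T P Q
      refine-within zero _ _ _ _ _ ()
      refine-within {Q} {P} {Z} (suc fuel) cQ P≼Q cZ sq@record { gap = f , Tf , Qf≢𝟘 , Zf≡𝟘 }
                    exceeds bound = ¬¬-excluded-middle >>= decide
        where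
        open Squeezed sq
        eliminate : ∀ {g} → T g → Sep Q Z g → Eliminant Q Z g → ¬ ¬ Between T P Q
        eliminate {g} Tg sep (Z′ , cZ′ , Z′g≡𝟘 , Z′-agrees) =
          refine-within fuel cQ P≼Q cZ′ squeezed′ (f , Tf , Pf≡𝟘 , Z′f≢𝟘) bound′
          where
          squeezed′ : Squeezed P Q Z′
          squeezed′ = record
            { agrees = λ y Ty Py≢𝟘 →
                let Qy≡Py = sym (≼∧≢𝟘⇒≡ (P≼Q y Ty) Py≢𝟘) in
                trans (eliminant-≢𝟘 Z′-agrees y (¬Sep-≡ (trans Qy≡Py (sym (agrees y Ty Py≢𝟘))))
                                    (λ Qy≡𝟘 → Py≢𝟘 (trans (sym Qy≡Py) Qy≡𝟘)))
                      Qy≡Py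
            ; vanishes = λ y Ty Qy≡𝟘 → trans (eliminant-𝟘 Z′-agrees y Qy≡𝟘) (vanishes y Ty Qy≡𝟘)
            ; gap = g , Tg , proj₂ sep , Z′g≡𝟘
            }
          Pf≡𝟘 : P f ≡ 𝟘
          Pf≡𝟘 with P f ≟ₛ 𝟘
          ... | yes Pf≡𝟘 = Pf≡𝟘
          ... | no Pf≢𝟘 = contradiction (trans (sym (agrees f Tf Pf≢𝟘)) Zf≡𝟘) Pf≢𝟘
          Z′f≢𝟘 : Z′ f ≢ 𝟘
          Z′f≢𝟘 Z′f≡𝟘 =
            Qf≢𝟘 (trans (sym (eliminant-≢𝟘 Z′-agrees f (¬Sep-𝟘ʳ Zf≡𝟘) Qf≢𝟘)) Z′f≡𝟘)
          sep′⇒sep : ∀ x → Sep Q Z′ x → Sep Q Z x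
          sep′⇒sep x sep′ with sep? Q Z x
          ... | yes s = s
          ... | no ¬s =
            contradiction sep′ (¬Sep-≡ (sym (eliminant-≢𝟘 Z′-agrees x ¬s (proj₂ sep′))))
          bound′ : count (sep? Q Z′) enum ℕ.< fuel
          bound′ = ℕP.<-≤-trans (count-strict (sep? Q Z) (sep? Q Z′) sep′⇒sep enum
                                  (enum-complete g) sep (¬Sep-𝟘ʳ Z′g≡𝟘))
                                (ℕP.≤-pred bound)
        decide : Dec (∃[ g ] (T g × Sep Q Z g)) → ¬ ¬ Between T P Q
        decide (yes (g , Tg , sep)) = eliminate Tg sep (cov-elim M cQ cZ g sep)
        decide (no ¬sep) = pure (between-if-unseparated P≼Q cZ sq exceeds λ y Ty s → ¬sep (y , Ty , s))

    refine : Cov M Q → (∀ y → T y → P y ≼ Q y) → Cov M Z → Squeezed P Q Z → Exceeds P Z →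
             ¬ ¬ Between T P Q
    refine cQ P≼Q cZ sq exceeds = refine-within _ cQ P≼Q cZ sq exceeds ℕP.≤-refl

  module Closure (enum : List E) (enum-complete : ∀ x → x ∈ enum) (S T : E → Set)
                 (S⊆T : ∀ y → S y → T y) (e : E) (e∈cl : InClosure S e) where

    open Refinement enum enum-complete T

    T⁺ : E → Set
    T⁺ y = T y ⊎ y ≡ e

    NonzeroLift : SignVector E → Set
    NonzeroLift X = ∃[ W ] (Cov M W × (∀ y → T y → W y ≡ X y) × W e ≢ 𝟘)

    step-fixing-e : Step T⁺ X Y → X e ≡ Y e → Step T X Y
    step-fixing-e (X≼Y , w , T⁺w , Xw≢Yw) Xe≡Ye = (λ y Ty → X≼Y y (inj₁ Ty)) , w , Tw T⁺w , Xw≢Yw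
      where
      Tw : T⁺ w → T w
      Tw (inj₁ Tw) = Tw
      Tw (inj₂ refl) = contradiction Xe≡Ye Xw≢Yw

    shrink : Path (Cov M) T⁺ X Z d → X e ≡ Z e → Path (Cov M) T X Z d
    shrink (nil cX) _ = nil cX
    shrink (cons cX st p) Xe≡Ze =
      let Xe≡Ye = ≼-antisym (proj₁ st e (inj₂ refl))
                            (subst (_ ≼_) (sym Xe≡Ze) (path-≼ p (inj₂ refl)))
      in cons cX (step-fixing-e st Xe≡Ye) (shrink p (trans (sym Xe≡Ye) Xe≡Ze))

    vanishing-below : Path (Cov M) T⁺ X Z d → Z e ≡ 𝟘 → X e ≡ Z e
    vanishing-below p Ze≡𝟘 = trans (≼𝟘⇒≡𝟘 (subst (_ ≼_) Ze≡𝟘 (path-≼ p (inj₂ refl)))) (sym Ze≡𝟘)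

    squeezing-covector : Cov M P → Cov M Q → Step T P Q → P e ≡ 𝟘 → Q e ≡ 𝟘 → NonzeroLift Q →
                         ∃[ Z ] (Cov M Z × Squeezed P Q Z × Z e ≢ 𝟘)
    squeezing-covector {P} {Q} cP cQ (P≼Q , f , Tf , Pf≢Qf) Pe≡𝟘 Qe≡𝟘 (W , cW , W≐Q , We≢𝟘) =
      from-eliminant (cov-elim M cW cV f separated)
      where
      -- V is P off its zeros, −Q on the rest of T and W at e: it separates from W at f, not at e.
      V : SignVector E
      V = P ∘ₛ (opp ∘′ (Q ∘ₛ (opp ∘′ W)))
      cV : Cov M V
      cV = cov-comp M cP (cov-neg M (cov-comp M cQ (cov-neg M cW)))
      V-off-P : ∀ y → T y → P y ≡ 𝟘 → V y ≡ opp (Q y)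
      V-off-P y Ty Py≡𝟘 with Q y ≟ₛ 𝟘
      ... | no Qy≢𝟘 = trans (∘ₛ-𝟘 P _ y Py≡𝟘) (cong opp (∘ₛ-≢𝟘 Q _ y Qy≢𝟘))
      ... | yes Qy≡𝟘 = trans (∘ₛ-𝟘 P _ y Py≡𝟘)
                             (cong opp (trans (∘ₛ-𝟘 Q _ y Qy≡𝟘)
                                              (trans (cong opp (trans (W≐Q y Ty) Qy≡𝟘)) (sym Qy≡𝟘))))
      Ve≡We : V e ≡ W e
      Ve≡We = trans (∘ₛ-𝟘 P _ e Pe≡𝟘) (trans (cong opp (∘ₛ-𝟘 Q _ e Qe≡𝟘)) (opp-involutive (W e)))
      Pf≡𝟘 : P f ≡ 𝟘
      Pf≡𝟘 = ≼∧≢⇒≡𝟘 (P≼Q f Tf) Pf≢Qf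
      Qf≢𝟘 : Q f ≢ 𝟘
      Qf≢𝟘 Qf≡𝟘 = Pf≢Qf (trans Pf≡𝟘 (sym Qf≡𝟘))
      separated : Sep W V f
      separated = trans (W≐Q f Tf)
                        (trans (sym (opp-involutive (Q f))) (cong opp (sym (V-off-P f Tf Pf≡𝟘)))) ,
                  λ Wf≡𝟘 → Qf≢𝟘 (trans (sym (W≐Q f Tf)) Wf≡𝟘)
      from-eliminant : Eliminant W V f → ∃[ Z ] (Cov M Z × Squeezed P Q Z × Z e ≢ 𝟘)
      from-eliminant (Z , cZ , Zf≡𝟘 , Z-agrees) =
        Z , cZ , record { agrees = agrees ; vanishes = vanishes ; gap = f , Tf , Qf≢𝟘 , Zf≡𝟘 } , Ze≢𝟘
        where
        agrees : ∀ y → T y → P y ≢ 𝟘 → Z y ≡ P y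
        agrees y Ty Py≢𝟘 =
          let Wy≡Py = trans (W≐Q y Ty) (sym (≼∧≢𝟘⇒≡ (P≼Q y Ty) Py≢𝟘))
              Wy≡Vy = trans Wy≡Py (sym (∘ₛ-≢𝟘 P _ y Py≢𝟘))
              Wy≢𝟘 = λ Wy≡𝟘 → Py≢𝟘 (trans (sym Wy≡Py) Wy≡𝟘)
          in trans (eliminant-≢𝟘 Z-agrees y (¬Sep-≡ Wy≡Vy) Wy≢𝟘) Wy≡Py
        vanishes : ∀ y → T y → Q y ≡ 𝟘 → Z y ≡ 𝟘
        vanishes y Ty Qy≡𝟘 =
          let Py≡𝟘 = ≼𝟘⇒≡𝟘 (subst (P y ≼_) Qy≡𝟘 (P≼Q y Ty))
          in trans (eliminant-𝟘 Z-agrees y (trans (W≐Q y Ty) Qy≡𝟘))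
                   (trans (V-off-P y Ty Py≡𝟘) (cong opp Qy≡𝟘))
        Ze≢𝟘 : Z e ≢ 𝟘
        Ze≢𝟘 Ze≡𝟘 =
          We≢𝟘 (trans (sym (eliminant-≢𝟘 Z-agrees e (¬Sep-≡ (sym Ve≡We)) We≢𝟘)) Ze≡𝟘)

    insert-between : Cov M P → Cov M Q → Step T P Q → P e ≡ 𝟘 → Q e ≡ 𝟘 →
                     NonzeroLift Q → ¬ NonzeroLift P → ¬ ¬ Between T P Q
    insert-between {P} {Q} cP cQ st Pe≡𝟘 Qe≡𝟘 liftQ ¬liftP
      with Z , cZ , sq , Ze≢𝟘 ← squeezing-covector cP cQ st Pe≡𝟘 Qe≡𝟘 liftQ =
      ¬¬-excluded-middle >>= decide
      where
      open Squeezed sq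
      decide : Dec (Exceeds P Z) → ¬ ¬ Between T P Q
      decide (yes exceeds) = refine cQ (proj₁ st) cZ sq exceeds
      decide (no ¬exceeds) = contradiction (Z , cZ , Z≐P , Ze≢𝟘) ¬liftP
        where
        Z≐P : ∀ y → T y → Z y ≡ P y
        Z≐P y Ty with P y ≟ₛ 𝟘 | Z y ≟ₛ 𝟘
        ... | no Py≢𝟘 | _ = agrees y Ty Py≢𝟘
        ... | yes Py≡𝟘 | yes Zy≡𝟘 = trans Zy≡𝟘 (sym Py≡𝟘)
        ... | yes Py≡𝟘 | no Zy≢𝟘 = contradiction (y , Ty , Py≡𝟘 , Zy≢𝟘) ¬exceeds

    nonzero-on-T : Cov M Q → NonzeroLift Q → ¬ ¬ (∃[ y ] (T y × Q y ≢ 𝟘))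
    nonzero-on-T {Q} cQ (W , cW , W≐Q , We≢𝟘) ¬nonzero = We≢𝟘 (e∈cl W cW W-vanishes-on-S)
      where
      W-vanishes-on-S : ∀ s → S s → W s ≡ 𝟘
      W-vanishes-on-S s Ss with Q s ≟ₛ 𝟘
      ... | yes Qs≡𝟘 = trans (W≐Q s (S⊆T s Ss)) Qs≡𝟘
      ... | no Qs≢𝟘 = contradiction (s , S⊆T s Ss , Qs≢𝟘) ¬nonzero

    extend-below : ∀ d → Path (Cov M) T⁺ X Q d → Q e ≡ 𝟘 → NonzeroLift Q →
                   ¬ ¬ (∃[ X′ ] Path (Cov M) T X′ Q (suc d))
    extend-below zero (nil cQ) _ liftQ = nonzero-on-T cQ liftQ >>= λ (y , Ty , Qy≢𝟘) →
      pure (_ , cons (cov-zero M) ((λ _ _ → 𝟘≼) , y , Ty , λ 𝟘≡Qy → Qy≢𝟘 (sym 𝟘≡Qy)) (nil cQ))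
    extend-below {X} {Q} (suc d) p Qe≡𝟘 liftQ
      with P , p′ , st , cP ← unsnoc p = ¬¬-excluded-middle >>= decide
      where
      cQ : Cov M Q
      cQ = top p
      Pe≡𝟘 : P e ≡ 𝟘
      Pe≡𝟘 = ≼𝟘⇒≡𝟘 (subst (P e ≼_) Qe≡𝟘 (proj₁ st e (inj₂ refl)))
      stT : Step T P Q
      stT = step-fixing-e st (trans Pe≡𝟘 (sym Qe≡𝟘))
      decide : Dec (NonzeroLift P) → ¬ ¬ (∃[ X′ ] Path (Cov M) T X′ Q (suc (suc d)))
      decide (yes liftP) = extend-below d p′ Pe≡𝟘 liftP >>= λ (X′ , q) → pure (X′ , snoc q stT cQ)
      decide (no ¬liftP) =
        insert-between cP cQ stT Pe≡𝟘 Qe≡𝟘 liftQ ¬liftP >>= λ (D , cD , P<D , D<Q) →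
        pure (X , snoc (snoc (shrink p′ (vanishing-below p′ Pe≡𝟘)) P<D cD) D<Q cQ)

    -- A step of a chain on T⁺ is invisible on T only where e leaves 0; the covector above then
    -- lifts the one below to a covector nonzero at e, and extend-below wins the step back.
    private
      drop-e-above : ∀ {B m} → Path (Cov M) T⁺ B X m → X e ≡ 𝟘 → Path (Cov M) T⁺ X Z d →
                     ¬ ¬ SomePath (Cov M) T (m + d)
      drop-e-above {X} {m = m} low Xe≡𝟘 (nil _) =
        pure (_ , _ , subst (Path (Cov M) T _ X) (sym (ℕP.+-identityʳ m))
                             (shrink low (vanishing-below low Xe≡𝟘)))
      drop-e-above {X} {Z} {d = suc d} {B} {m} low Xe≡𝟘 (cons {Y = Y} cX st rest) with Y e ≟ₛ 𝟘
      ... | yes Ye≡𝟘 = subst (¬_ ∘′ ¬_ ∘′ SomePath (Cov M) T) (sym (ℕP.+-suc m d))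
                             (drop-e-above (snoc low st (bottom rest)) Ye≡𝟘 rest)
      ... | no Ye≢𝟘 = ¬¬-excluded-middle >>= decide
        where
        lowT : Path (Cov M) T B X m
        lowT = shrink low (vanishing-below low Xe≡𝟘)
        restT : Path (Cov M) T Y Z d
        restT = shrink rest (≼∧≢𝟘⇒≡ (path-≼ rest (inj₂ refl)) Ye≢𝟘)
        decide : Dec (∃[ y ] (T y × X y ≢ Y y)) → ¬ ¬ SomePath (Cov M) T (m + suc d)
        decide (yes witness) =
          pure (_ , _ , lowT ++ₚ cons cX ((λ y Ty → proj₁ st y (inj₁ Ty)) , witness) restT)
        decide (no ¬witness) =
          extend-below m low Xe≡𝟘 (Y , bottom rest , (λ y Ty → sym (X≐Y y Ty)) , Ye≢𝟘) >>= λ (B′ , q) →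
          let Z′ , r = rebase cX X≐Y restT
          in pure (B′ , Z′ , subst (Path (Cov M) T B′ Z′) (sym (ℕP.+-suc m d)) (q ++ₚ r))
          where
          X≐Y : ∀ y → T y → X y ≡ Y y
          X≐Y y Ty with X y ≟ₛ Y y
          ... | yes Xy≡Yy = Xy≡Yy
          ... | no Xy≢Yy = contradiction (y , Ty , Xy≢Yy) ¬witness

    drop-closure-point : Path (Cov M) T⁺ X Z d → ¬ ¬ SomePath (Cov M) T d
    drop-closure-point {X} p with X e ≟ₛ 𝟘
    ... | yes Xe≡𝟘 = drop-e-above (nil (bottom p)) Xe≡𝟘 p
    ... | no Xe≢𝟘 = pure (_ , _ , shrink p (≼∧≢𝟘⇒≡ (path-≼ p (inj₂ refl)) Xe≢𝟘))

  module Span (enum : List E) (enum-complete : ∀ x → x ∈ enum) (S : E → Set) where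

    Span : List E → E → Set
    Span l y = S y ⊎ (InClosure S y × y ∈ l)

    private
      Span-∷ : ∀ {x l y} → Span l y → Span (x ∷ l) y
      Span-∷ (inj₁ Sy) = inj₁ Sy
      Span-∷ (inj₂ (y∈cl , y∈l)) = inj₂ (y∈cl , there y∈l)

      Span-[] : ∀ {y} → Span [] y → S y
      Span-[] (inj₁ Sy) = Sy

    chain-from-span : ∀ l → Path (Cov M) (Span l) X Z d → ¬ ¬ SomePath (Cov M) S d
    chain-from-span [] p = pure (_ , _ , mapStep (Step-cong (λ _ → inj₁) (λ _ → Span-[])) p)
    chain-from-span (x ∷ l) p = ¬¬-excluded-middle >>= decide
      where
      decide : Dec (InClosure S x) → ¬ ¬ SomePath (Cov M) S _
      decide (yes x∈cl) = drop-closure-point (mapStep (Step-cong to-Span to-T⁺) p) >>= λ (_ , _ , q) →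
                          chain-from-span l q
        where
        open Closure enum enum-complete S (Span l) (λ _ → inj₁) x x∈cl
        to-Span : ∀ y → T⁺ y → Span (x ∷ l) y
        to-Span y (inj₁ y∈Span) = Span-∷ y∈Span
        to-Span y (inj₂ refl) = inj₂ (x∈cl , here refl)
        to-T⁺ : ∀ y → Span (x ∷ l) y → T⁺ y
        to-T⁺ y (inj₁ Sy) = inj₁ (inj₁ Sy)
        to-T⁺ y (inj₂ (_ , here refl)) = inj₂ refl
        to-T⁺ y (inj₂ (y∈cl , there y∈l)) = inj₁ (inj₂ (y∈cl , y∈l))
      decide (no x∉cl) = chain-from-span l (mapStep (Step-cong (λ _ → Span-∷) to-Span-l) p)
        where
        to-Span-l : ∀ y → Span (x ∷ l) y → Span l y
        to-Span-l y (inj₁ Sy) = inj₁ Sy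
        to-Span-l y (inj₂ (x∈cl , here refl)) = contradiction x∈cl x∉cl
        to-Span-l y (inj₂ (y∈cl , there y∈l)) = inj₂ (y∈cl , y∈l)

-- Sweeps and the little oriented matroid

cmpSign : ℕ → ℕ → Sign
cmpSign x y with ℕP.<-cmp x y
... | tri< _ _ _ = ⊕
... | tri≈ _ _ _ = 𝟘
... | tri> _ _ _ = ⊖

cmpSign-refl : ∀ x → cmpSign x x ≡ 𝟘
cmpSign-refl x with ℕP.<-cmp x x
... | tri< x<x _ _ = contradiction x<x (ℕP.<-irrefl refl)
... | tri≈ _ _ _ = refl
... | tri> _ _ x>x = contradiction x>x (ℕP.<-irrefl refl)

cmpSign-𝟘 : ∀ x y → cmpSign x y ≡ 𝟘 → x ≡ y
cmpSign-𝟘 x y eq with ℕP.<-cmp x y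
... | tri≈ _ x≡y _ = x≡y

opp-cmpSign : ∀ x y → opp (cmpSign x y) ≡ cmpSign y x
opp-cmpSign x y with ℕP.<-cmp x y | ℕP.<-cmp y x
... | tri< _ _ _ | tri> _ _ _ = refl
... | tri≈ _ _ _ | tri≈ _ _ _ = refl
... | tri> _ _ _ | tri< _ _ _ = refl
... | tri< x<y _ _ | tri< y<x _ _ = contradiction y<x (ℕP.<-asym x<y)
... | tri< x<y _ _ | tri≈ _ y≡x _ = contradiction x<y (ℕP.<-irrefl (sym y≡x))
... | tri≈ _ x≡y _ | tri< y<x _ _ = contradiction y<x (ℕP.<-irrefl (sym x≡y))
... | tri≈ _ x≡y _ | tri> _ _ x<y = contradiction x<y (ℕP.<-irrefl x≡y)
... | tri> _ _ y<x | tri≈ _ y≡x _ = contradiction y<x (ℕP.<-irrefl y≡x)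
... | tri> _ _ y<x | tri> _ _ x<y = contradiction x<y (ℕP.<-asym y<x)

sweepSign-cmp : ∀ {n l} (p : Fin n → Fin l) i j (i<j : i F.< j) →
                sweepSign p (i , j , i<j) ≡ cmpSign (toℕ (p i)) (toℕ (p j))
sweepSign-cmp p i j _ with toℕ (p i) <? toℕ (p j) | toℕ (p j) <? toℕ (p i)
                         | ℕP.<-cmp (toℕ (p i)) (toℕ (p j))
... | yes _ | _ | tri< _ _ _ = refl
... | no _ | yes _ | tri> _ _ _ = refl
... | no _ | no _ | tri≈ _ _ _ = refl
... | yes a<b | _ | tri≈ _ a≡b _ = contradiction a<b (ℕP.<-irrefl a≡b)
... | yes a<b | _ | tri> _ _ b<a = contradiction b<a (ℕP.<-asym a<b)
... | no a≮b | _ | tri< a<b _ _ = contradiction a<b a≮b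
... | no _ | yes b<a | tri≈ _ a≡b _ = contradiction b<a (ℕP.<-irrefl (sym a≡b))
... | no _ | no b≮a | tri> _ _ b<a = contradiction b<a b≮a

thresholdSign : ℕ → ℕ → ℕ → Sign
thresholdSign q lo hi with q ≤? lo
... | yes _ = ⊖
... | no _ with hi <? q
...   | yes _ = ⊕
...   | no _ = 𝟘

littleSign-thresholds : ∀ q k → littleSign q k ≡ thresholdSign q ⌊ k ∸ 1 /2⌋ ⌊ k /2⌋
littleSign-thresholds q k with q ≤? ⌊ k ∸ 1 /2⌋
... | yes _ = refl
... | no _ with ⌊ k /2⌋ <? q
...   | yes _ = refl
...   | no _ = refl

⌊1+n+n/2⌋≡n : ∀ n → ⌊ suc (n + n) /2⌋ ≡ n
⌊1+n+n/2⌋≡n zero = refl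
⌊1+n+n/2⌋≡n (suc n) = cong suc (trans (cong ⌊_/2⌋ (ℕP.+-suc n n)) (⌊1+n+n/2⌋≡n n))

lowerZero : Sign → Sign
lowerZero 𝟘 = ⊖
lowerZero s = s

≼-lowerZero : ∀ s → s ≼ lowerZero s
≼-lowerZero ⊕ = ≼-refl
≼-lowerZero ⊖ = ≼-refl
≼-lowerZero 𝟘 = 𝟘≼

thresholdSign-even : ∀ a x → thresholdSign (suc x) a (suc a) ≡ cmpSign a x
thresholdSign-even a x with suc x ≤? a | ℕP.<-cmp a x
... | yes _ | tri> _ _ _ = refl
... | yes x<a | tri< a<x _ _ = contradiction a<x (ℕP.<-asym x<a)
... | yes x<a | tri≈ _ a≡x _ = contradiction x<a (ℕP.<-irrefl (sym a≡x))
... | no x≮a | tri> _ _ x<a = contradiction x<a x≮a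
... | no _ | tri< a<x _ _ with suc a <? suc x
...   | yes _ = refl
...   | no a≮x = contradiction (s≤s a<x) a≮x
thresholdSign-even a x | no _ | tri≈ _ a≡x _ with suc a <? suc x
...   | yes a<x = contradiction (ℕP.≤-pred a<x) (ℕP.<-irrefl a≡x)
...   | no _ = refl

thresholdSign-odd : ∀ a x → thresholdSign (suc x) (suc a) (suc a) ≡ lowerZero (cmpSign a x)
thresholdSign-odd a x with suc x ≤? suc a | ℕP.<-cmp a x
... | yes _ | tri≈ _ _ _ = refl
... | yes _ | tri> _ _ _ = refl
... | yes x≤a | tri< a<x _ _ = contradiction (ℕP.≤-trans (s≤s a<x) x≤a) (ℕP.<-irrefl refl)
... | no x≰a | tri≈ _ a≡x _ = contradiction (s≤s (ℕP.≤-reflexive (sym a≡x))) x≰a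
... | no x≰a | tri> _ _ x<a = contradiction (s≤s (ℕP.<⇒≤ x<a)) x≰a
... | no _ | tri< a<x _ _ with suc a <? suc x
...   | yes _ = refl
...   | no a≮x = contradiction (s≤s a<x) a≮x

littleSign-even : ∀ a x → littleSign (suc x) (suc a + suc a) ≡ cmpSign a x
littleSign-even a x = begin
  littleSign (suc x) (suc a + suc a)
    ≡⟨ littleSign-thresholds (suc x) (suc a + suc a) ⟩
  thresholdSign (suc x) ⌊ a + suc a /2⌋ ⌊ suc a + suc a /2⌋
    ≡⟨ cong₂ (thresholdSign (suc x)) (trans (cong ⌊_/2⌋ (ℕP.+-suc a a)) (⌊1+n+n/2⌋≡n a))
                                      (sym (ℕP.n≡⌊n+n/2⌋ (suc a))) ⟩
  thresholdSign (suc x) a (suc a)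
    ≡⟨ thresholdSign-even a x ⟩
  cmpSign a x ∎
  where open ≡-Reasoning

littleSign-odd : ∀ a x → littleSign (suc x) (suc (suc a + suc a)) ≡ lowerZero (cmpSign a x)
littleSign-odd a x = begin
  littleSign (suc x) (suc (suc a + suc a))
    ≡⟨ littleSign-thresholds (suc x) (suc (suc a + suc a)) ⟩
  thresholdSign (suc x) ⌊ suc a + suc a /2⌋ ⌊ suc (suc a + suc a) /2⌋
    ≡⟨ cong₂ (thresholdSign (suc x)) (sym (ℕP.n≡⌊n+n/2⌋ (suc a))) (⌊1+n+n/2⌋≡n (suc a)) ⟩
  thresholdSign (suc x) (suc a) (suc a)
    ≡⟨ thresholdSign-odd a x ⟩
  lowerZero (cmpSign a x) ∎
  where open ≡-Reasoning

Pair-≡ : ∀ {n} {i j : Fin n} (p q : i F.< j) → _≡_ {A = Pair n} (i , j , p) (i , j , q)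
Pair-≡ p q = cong (λ r → _ , _ , r) (ℕP.<-irrelevant p q)

pairsAt : ∀ {n} → Fin n → Fin n → List (Pair n)
pairsAt i j with i F.<? j
... | yes i<j = (i , j , i<j) ∷ []
... | no _ = []

allPairs : ∀ n → List (Pair n)
allPairs n = concatMap (λ i → concatMap (pairsAt i) (allFin n)) (allFin n)

∈-allPairs : ∀ {n} (e : Pair n) → e ∈ allPairs n
∈-allPairs {n} (i , j , i<j) =
  ∈-concatMap⁺ _ (lose (∈-allFin i) (∈-concatMap⁺ (pairsAt i) (lose (∈-allFin j) ∈-pairsAt)))
  where
  ∈-pairsAt : (i , j , i<j) ∈ pairsAt i j
  ∈-pairsAt with i F.<? j
  ... | yes i<j′ = here (Pair-≡ i<j i<j′)
  ... | no i≮j = contradiction i<j i≮j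

double-bound : ∀ {l} (q : Fin l) → suc (toℕ q) + suc (toℕ q) ℕ.≤ l + l
double-bound q = ℕP.+-mono-≤ (FP.toℕ<n q) (FP.toℕ<n q)

Inside : ∀ {n} → (Fin n → Set) → Pair n → Set
Inside U (i , j , _) = U i × U j

module Sweep {n : ℕ} (M : OrientedMatroid (Pair n)) (sweep : IsSweep M)
             (U : Fin n → Set) (i₀ : Fin n) (Ui₀ : U i₀) where

  private
    variable
      C C′ X Z : SignVector (Pair n)
      d : ℕ

  Star : Pair n → Set
  Star (i , j , _) = (i ≡ i₀ × U j) ⊎ (j ≡ i₀ × U i)

  same-block : ∀ (W : SignVector (Pair n)) {l} (p : Fin n → Fin l) → (∀ e → W e ≡ sweepSign p e) →
               (∀ s → Star s → W s ≡ 𝟘) → ∀ a → U a → toℕ (p a) ≡ toℕ (p i₀)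
  same-block W p W≡ W-star a Ua with FP.<-cmp a i₀
  ... | tri< a<i₀ _ _ = cmpSign-𝟘 _ _ (trans (sym (sweepSign-cmp p a i₀ a<i₀))
                          (trans (sym (W≡ (a , i₀ , a<i₀))) (W-star (a , i₀ , a<i₀) (inj₂ (refl , Ua)))))
  ... | tri≈ _ refl _ = refl
  ... | tri> _ _ i₀<a = sym (cmpSign-𝟘 _ _ (trans (sym (sweepSign-cmp p i₀ a i₀<a))
                          (trans (sym (W≡ (i₀ , a , i₀<a))) (W-star (i₀ , a , i₀<a) (inj₁ (refl , Ua))))))

  inside-in-closure : ∀ y → Inside U y → InClosure M Star y
  inside-in-closure (a , b , a<b) (Ua , Ub) W cW W-star with l , p , _ , W≡ ← sweep W cW =
    begin
      W (a , b , a<b)                        ≡⟨ W≡ _ ⟩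
      sweepSign p (a , b , a<b)              ≡⟨ sweepSign-cmp p a b a<b ⟩
      cmpSign (toℕ (p a)) (toℕ (p b))        ≡⟨ cong₂ cmpSign (same-block W p W≡ W-star a Ua)
                                                               (same-block W p W≡ W-star b Ub) ⟩
      cmpSign (toℕ (p i₀)) (toℕ (p i₀))      ≡⟨ cmpSign-refl _ ⟩
      𝟘                                      ∎
    where open ≡-Reasoning

  -- With q the block of i₀ in the sweep of C, starView C and starView⁻ C are C^{2q} and
  -- C^{2q+1} restricted to [n] (see starView-little and starView⁻-little).
  starView : SignVector (Pair n) → Fin n → Sign
  starView C u with FP.<-cmp i₀ u
  ... | tri< i₀<u _ _ = C (i₀ , u , i₀<u)
  ... | tri≈ _ _ _ = 𝟘
  ... | tri> _ _ u<i₀ = opp (C (u , i₀ , u<i₀))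

  starView⁻ : SignVector (Pair n) → Fin n → Sign
  starView⁻ C u = lowerZero (starView C u)

  starView-cmp : ∀ {l} (p : Fin n → Fin l) → (∀ e → C e ≡ sweepSign p e) →
                 ∀ u → starView C u ≡ cmpSign (toℕ (p i₀)) (toℕ (p u))
  starView-cmp p C≡ u with FP.<-cmp i₀ u
  ... | tri< i₀<u _ _ = trans (C≡ _) (sweepSign-cmp p i₀ u i₀<u)
  ... | tri≈ _ refl _ = sym (cmpSign-refl _)
  ... | tri> _ _ u<i₀ = trans (cong opp (trans (C≡ _) (sweepSign-cmp p u i₀ u<i₀))) (opp-cmpSign _ _)

  starView-i₀ : ∀ C → starView C i₀ ≡ 𝟘
  starView-i₀ C with FP.<-cmp i₀ i₀
  ... | tri< i₀<i₀ _ _ = contradiction i₀<i₀ (FP.<-irrefl refl)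
  ... | tri≈ _ _ _ = refl
  ... | tri> _ _ i₀<i₀ = contradiction i₀<i₀ (FP.<-irrefl refl)

  starView-little : Cov M C → LittleCov M (starView C)
  starView-little {C} cC with l , p , surj , C≡ ← sweep C cC =
    C , cC , l , p , surj , C≡ , suc a + suc a , s≤s z≤n , ℕP.m≤n⇒m≤1+n (double-bound (p i₀)) ,
    λ u → trans (starView-cmp p C≡ u) (sym (littleSign-even a (toℕ (p u))))
    where
    a = toℕ (p i₀)

  starView⁻-little : Cov M C → LittleCov M (starView⁻ C)
  starView⁻-little {C} cC with l , p , surj , C≡ ← sweep C cC =
    C , cC , l , p , surj , C≡ , suc (suc a + suc a) , s≤s z≤n , s≤s (double-bound (p i₀)) ,
    λ u → trans (cong lowerZero (starView-cmp p C≡ u)) (sym (littleSign-odd a (toℕ (p u))))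
    where
    a = toℕ (p i₀)

  starView-step : Step Star C C′ → Step U (starView C) (starView C′)
  starView-step {C} {C′} (C≼C′ , w , Star-w , Cw≢C′w) = conform , moved w Star-w Cw≢C′w
    where
    conform : ∀ u → U u → starView C u ≼ starView C′ u
    conform u Uu with FP.<-cmp i₀ u
    ... | tri< i₀<u _ _ = C≼C′ (i₀ , u , i₀<u) (inj₁ (refl , Uu))
    ... | tri≈ _ _ _ = ≼-refl
    ... | tri> _ _ u<i₀ = opp-mono-≼ (C≼C′ (u , i₀ , u<i₀) (inj₂ (refl , Uu)))
    moved : ∀ y → Star y → C y ≢ C′ y → ∃[ u ] (U u × starView C u ≢ starView C′ u)
    moved (i , j , i<j) (inj₁ (refl , Uj)) Cy≢C′y = j , Uj , differs
      where
      differs : starView C j ≢ starView C′ j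
      differs with FP.<-cmp i j
      ... | tri< i<j′ _ _ = λ eq → Cy≢C′y (subst (λ y → C y ≡ C′ y) (Pair-≡ i<j′ i<j) eq)
      ... | tri≈ _ i≡j _ = contradiction i<j (FP.<-irrefl i≡j)
      ... | tri> _ _ j<i = contradiction j<i (FP.<-asym i<j)
    moved (i , j , i<j) (inj₂ (refl , Ui)) Cy≢C′y = i , Ui , differs
      where
      differs : starView C i ≢ starView C′ i
      differs with FP.<-cmp j i
      ... | tri< j<i _ _ = contradiction j<i (FP.<-asym i<j)
      ... | tri≈ _ j≡i _ = contradiction i<j (FP.<-irrefl (sym j≡i))
      ... | tri> _ _ i<j′ =
        λ eq → Cy≢C′y (subst (λ y → C y ≡ C′ y) (Pair-≡ i<j′ i<j) (opp-injective eq))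

  starView⁻-step : ∀ C → Step U (starView C) (starView⁻ C)
  starView⁻-step C = (λ u _ → ≼-lowerZero (starView C u)) , i₀ , Ui₀ , differs (starView-i₀ C)
    where
    differs : ∀ {a} → a ≡ 𝟘 → a ≢ lowerZero a
    differs refl ()

  starView-path : Path (Cov M) Star X Z d → Path (LittleCov M) U (starView X) (starView Z) d
  starView-path (nil cX) = nil (starView-little cX)
  starView-path (cons cX st p) = cons (starView-little cX) (starView-step st) (starView-path p)

  little-chain : (F : Pair n → Set) → (∀ y → F y → Inside U y) →
                 Path (Cov M) F X Z d → ¬ ¬ Chain (LittleCov M) U (suc d)
  little-chain F F⊆Inside p =
    let _ , p-span = widen M F⊆Span (bottom p) (λ _ _ → refl) p
    in chain-from-span (allPairs n) p-span >>= λ (_ , Z′ , q) →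
       pure (toChain (snoc (starView-path q) (starView⁻-step Z′) (starView⁻-little (top q))))
    where
    open Span M (allPairs n) ∈-allPairs Star
    F⊆Span : ∀ y → F y → Span (allPairs n) y
    F⊆Span y Fy = inj₂ (inside-in-closure y (F⊆Inside y Fy) , ∈-allPairs y)

-- Splitting a chain along a partition

sumℕ : ∀ {l} → (Fin l → ℕ) → ℕ
sumℕ = foldr _+_ 0

sumℕ-updateAt-suc : ∀ {l} (s : Fin l → ℕ) k → sumℕ (updateAt s k suc) ≡ suc (sumℕ s)
sumℕ-updateAt-suc s fzero = refl
sumℕ-updateAt-suc s (fsuc k) =
  trans (cong (_+_ (s fzero)) (sumℕ-updateAt-suc (λ j → s (fsuc j)) k)) (ℕP.+-suc (s fzero) _)

sumℕ≤sumFin-pred : ∀ {l} (s rs : Fin l → ℕ) → (∀ k → suc (s k) ℕ.≤ rs k) →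
                   + sumℕ s ≤ sumFin (λ k → + rs k - + 1)
sumℕ≤sumFin-pred {zero} s rs s<rs = +≤+ z≤n
sumℕ≤sumFin-pred {suc l} s rs s<rs =
  ℤP.+-mono-≤ (head-bound (s<rs fzero))
              (sumℕ≤sumFin-pred (λ k → s (fsuc k)) (λ k → rs (fsuc k)) (λ k → s<rs (fsuc k)))
  where
  head-bound : ∀ {a b} → suc a ℕ.≤ b → + a ≤ + b - + 1
  head-bound (s≤s a≤b) = +≤+ a≤b

module Splitting {E : Set} (M : OrientedMatroid E) (G : E → Set) {l : ℕ} (c : E → Fin l) where

  Part : Fin l → E → Set
  Part k y = G y × c y ≡ k

  PartChains : SignVector E → (Fin l → ℕ) → Set
  PartChains X s = ∀ k → ∃[ Xₖ ] ∃[ Zₖ ]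
    (Path (Cov M) (Part k) Xₖ Zₖ (s k) × (∀ y → Part k y → X y ≼ Xₖ y))

  split : ∀ {X Z r} → Path (Cov M) G X Z r → ∃[ s ] (r ℕ.≤ sumℕ s × PartChains X s)
  split {X} (nil cX) = (λ _ → 0) , z≤n , λ k → X , X , nil cX , λ _ _ → ≼-refl
  split {X} {r = suc r} (cons {Y = Y} cX (X≼Y , w , Gw , Xw≢Yw) rest)
    with s , r≤Σs , chains ← split rest =
    updateAt s (c w) suc ,
    subst (suc r ℕ.≤_) (sym (sumℕ-updateAt-suc s (c w))) (s≤s r≤Σs) ,
    chains′
    where
    chains′ : PartChains X (updateAt s (c w) suc)
    chains′ k with Yₖ , Zₖ , p , Y≼Yₖ ← chains k | k F.≟ c w
    ... | yes refl =
      X , Zₖ , subst (Path (Cov M) (Part k) X Zₖ) (sym (updateAt-updates k s)) (cons cX step p) ,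
      λ _ _ → ≼-refl
      where
      Xw≡𝟘 : X w ≡ 𝟘
      Xw≡𝟘 = ≼∧≢⇒≡𝟘 (X≼Y w Gw) Xw≢Yw
      step : Step (Part k) X Yₖ
      step = (λ y Py → ≼-trans (X≼Y y (proj₁ Py)) (Y≼Yₖ y Py)) , w , (Gw , refl) ,
             λ Xw≡Yₖw → Xw≢Yw (trans Xw≡𝟘 (sym (≼𝟘⇒≡𝟘 (subst (Y w ≼_) (trans (sym Xw≡Yₖw) Xw≡𝟘)
                                                           (Y≼Yₖ w (Gw , refl))))))
    ... | no k≢cw =
      Yₖ , Zₖ , subst (Path (Cov M) (Part k) Yₖ Zₖ) (sym (updateAt-minimal k (c w) s k≢cw)) p ,
      λ y Py → ≼-trans (X≼Y y (proj₁ Py)) (Y≼Yₖ y Py)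

-- Closure membership is undecidable, so the chain surgery above is classical; the bound is
-- decidable and can be extracted from its double negation.
little-rank-bound : ∀ {n} (M : OrientedMatroid (Pair n)) → IsSweep M →
                    ∀ {U F X Z d r} → ∃ U → (∀ y → F y → Inside U y) →
                    Path (Cov M) F X Z d → IsRank (LittleCov M) U r → suc d ℕ.≤ r
little-rank-bound M sweep {U} {F} (i₀ , Ui₀) F⊆Inside p (_ , maximal) =
  decidable-stable (_ ℕ.≤? _)
    (¬¬-map (maximal _) (Sweep.little-chain M sweep U i₀ Ui₀ F F⊆Inside p))

chain-length-on-empty : ∀ {E : Set} {C : SignVector E → Set} {S : E → Set} {r} →
                        Chain C S r → (∀ e → ¬ S e) → r ≡ 0
chain-length-on-empty {r = zero} _ _ = refl
chain-length-on-empty {r = suc r} (_ , _ , steps) S-empty with _ , e , Se , _ ← steps fzero =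
  contradiction Se (S-empty e)

theorem5p2 : (n : ℕ) (M : OrientedMatroid (Pair n)) → IsSweep M →
    (G : Pair n → Bool) (r : ℕ) (s : ℤ) →
    IsRank (Cov M) (In G) r → IsDRank (LittleCov M) G s → + r ≤ s
theorem5p2 n M sweep G r _ (chain , _) (inj₁ (G-empty , refl)) =
  +≤+ (ℕP.≤-reflexive (chain-length-on-empty {C = Cov M} chain G-empty))
theorem5p2 n M sweep G r _ (chain , _) (inj₂ (_ , (l , c , parts , rs , ranks , refl) , _))
  with s , r≤Σs , chains ← Splitting.split M (In G) c (proj₂ (fromChain chain)) =
  ℤP.≤-trans (+≤+ r≤Σs) (sumℕ≤sumFin-pred s rs part-bound)
  where
  open Splitting M (In G) c
  part-inside : ∀ k y → Part k y → Inside (UnionPart G c k) y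
  part-inside k y@(_ , _ , _) (Gy , cy≡k) = (y , Gy , cy≡k , inj₁ refl) , (y , Gy , cy≡k , inj₂ refl)
  part-bound : ∀ k → suc (s k) ℕ.≤ rs k
  part-bound k with e , Ge , ce≡k ← parts k | _ , _ , p , _ ← chains k =
    little-rank-bound M sweep (fstP e , e , Ge , ce≡k , inj₁ refl) (part-inside k) p (ranks k)
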